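{- Let $\mathbb{F}_q$ be a finite field, $a\in\mathbb{F}_q^*$ and $m$ a positive integer. Then $\tilde{P}_m(a)=\tilde{P}_m(1)$.
   Context: $\tilde{P}_m(z)$ denotes the number of multisets of $m$ elements of $\mathbb{F}_q^*=\mathbb{F}_q\setminus\{0\}$ (repetitions allowed) whose sum is $z$ (partitions of $z$ into $m$ parts). -}

module Defs where

open import Level using (0ℓ)
open import Data.Nat using (ℕ; zero; suc)
open import Data.Fin using (Fin)
open import Data.Fin.Properties using () renaming (_≟_ to _≟ᶠ_)
open import Data.List using (List; []; _∷_; _++_; map; filter; length; foldr; allFin)
open import Data.Product using (Σ; _,_)
open import Relation.Binary.PropositionalEquality using (_≡_; _≢_; cong)
open import Relation.Nullary using (Dec; yes; no; ¬_)
open import Relation.Nullary.Decidable using (map′; ¬?)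
open import Function.Bundles using (_↔_; Inverse)
open import Algebra.Structures using (IsCommutativeRing)

record FiniteField : Set₁ where
  field
    Carrier : Set
    _+_ _*_ : Carrier → Carrier → Carrier
    -_      : Carrier → Carrier
    0# 1#   : Carrier
    isCommutativeRing : IsCommutativeRing _≡_ _+_ _*_ -_ 0# 1#
    0≢1     : 0# ≢ 1#
    inverse : ∀ x → x ≢ 0# → Σ Carrier (λ y → (x * y) ≡ 1#)
    q       : ℕ
    enum    : Fin q ↔ Carrier

module _ (F : FiniteField) where
  open FiniteField F

  private
    module E = Inverse enum

  _≟F_ : (x y : Carrier) → Dec (x ≡ y)
  x ≟F y = map′ (λ e → trans' (sym' (E.strictlyInverseˡ x)) (trans' (cong E.to e) (E.strictlyInverseˡ y)))
                (cong E.from) (E.from x ≟ᶠ E.from y)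
    where
      open import Relation.Binary.PropositionalEquality using () renaming (trans to trans'; sym to sym')

  elements : List Carrier
  elements = map E.to (allFin q)

  nonzeroElements : List Carrier
  nonzeroElements = filter (λ x → ¬? (x ≟F 0#)) elements

  sumF : List Carrier → Carrier
  sumF = foldr _+_ 0#

-- multisets of size m drawn from a list of (distinct) elements, each
-- multiset represented exactly once as a list respecting the order of xs
multisets : {A : Set} → List A → ℕ → List (List A)
multisets []       zero    = [] ∷ []
multisets []       (suc m) = []
multisets (x ∷ xs) zero    = [] ∷ []
multisets (x ∷ xs) (suc m) = map (x ∷_) (multisets (x ∷ xs) m) ++ multisets xs (suc m)

P̃ : (F : FiniteField) → ℕ → FiniteField.Carrier F → ℕ
P̃ F m z = length (filter (λ s → _≟F_ F (sumF F s) z) (multisets (nonzeroElements F) m))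

-- In any abelian group, the number count xs m z of m-multisets from xs with
-- sum z satisfies count (x ∷ xs) (m + 1) z = count (x ∷ xs) m (z - x) +
-- count xs (m + 1) z (a multiset contains x or it does not); by induction on m
-- this makes count invariant under permuting xs. Multiplication by a ≠ 0
-- permutes F_q^* and maps multisets of sum 1 bijectively onto multisets of
-- sum a, so P̃_m(a) = count (a F_q^*) m a = count F_q^* m 1 = P̃_m(1).
module Submission where

open import Defs
open import Level using (Level)
open import Algebra.Bundles using (AbelianGroup)
open import Algebra.Core using (Op₁; Op₂)
open import Algebra.Structures using (IsGroup; IsAbelianGroup; IsCommutativeRing)
import Algebra.Properties.AbelianGroup as AbelianGroupProperties
import Algebra.Properties.CommutativeSemigroup as CommutativeSemigroupProperties
open import Data.Nat using (ℕ; zero; suc) renaming (_+_ to _+ℕ_)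
open import Data.Nat.Properties using (+-comm; +-assoc; +-commutativeSemigroup)
open import Data.List using (List; []; _∷_; _++_; map; filter; length; foldr)
open import Data.List.Properties using (length-++; filter-++; filter-≐; map-++; map-∘; length-map)
open import Data.List.Membership.Propositional using (_∈_)
open import Data.List.Membership.Propositional.Properties using (∈-map⁺; ∈-map⁻; ∈-filter⁺; ∈-filter⁻; ∈-allFin)
open import Data.List.Membership.Propositional.Properties.WithK using (unique∧set⇒bag)
open import Data.List.Relation.Binary.BagAndSetEquality using (∼bag⇒↭)
open import Data.List.Relation.Binary.Permutation.Propositional as ↭ using (_↭_)
open import Data.List.Relation.Unary.Unique.Propositional using (Unique)
import Data.List.Relation.Unary.Unique.Propositional.Properties as Unique
open import Data.Bool using (true; false)
open import Data.Product using (proj₁; proj₂; _,_)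
open import Function using (_∘_; _⇔_; mk⇔)
open import Function.Bundles using (Injection; Inverse; Equivalence)
open import Function.Definitions using (Injective)
open import Function.Properties.Inverse using (↔⇒↣)
open import Relation.Binary.Definitions using (DecidableEquality)
open import Relation.Binary.PropositionalEquality
  using (_≡_; _≢_; refl; sym; trans; cong; cong₂; subst; module ≡-Reasoning)
open import Relation.Nullary using (does; ¬?)
open import Relation.Unary using (Pred; Decidable)

private
  variable
    ℓ₁ ℓ₂ ℓ : Level

filter-map : {A : Set ℓ₁} {B : Set ℓ₂} {P : Pred B ℓ} (P? : Decidable P) (f : A → B) (xs : List A) →
             filter P? (map f xs) ≡ map f (filter (P? ∘ f) xs)
filter-map P? f [] = refl
filter-map P? f (x ∷ xs) with does (P? (f x))
... | true  = cong (f x ∷_) (filter-map P? f xs)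
... | false = filter-map P? f xs

multisets-map : {A B : Set} (f : A → B) (xs : List A) (m : ℕ) →
                multisets (map f xs) m ≡ map (map f) (multisets xs m)
multisets-map f []       zero    = refl
multisets-map f []       (suc m) = refl
multisets-map f (x ∷ xs) zero    = refl
multisets-map f (x ∷ xs) (suc m) = begin
  map (f x ∷_) (multisets (map f (x ∷ xs)) m) ++ multisets (map f xs) (suc m)
    ≡⟨ cong₂ (λ M N → map (f x ∷_) M ++ N) (multisets-map f (x ∷ xs) m) (multisets-map f xs (suc m)) ⟩
  map (f x ∷_) (map (map f) M) ++ map (map f) N
    ≡⟨ cong (_++ map (map f) N) (trans (sym (map-∘ M)) (map-∘ M)) ⟩
  map (map f) (map (x ∷_) M) ++ map (map f) N
    ≡⟨ sym (map-++ (map f) (map (x ∷_) M) N) ⟩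
  map (map f) (map (x ∷_) M ++ N) ∎
  where
    open ≡-Reasoning
    M = multisets (x ∷ xs) m
    N = multisets xs (suc m)

module MultisetSum {A : Set} {_+_ : Op₂ A} {0# : A} { -_ : Op₁ A}
                   (isAbelianGroup : IsAbelianGroup _≡_ _+_ 0# -_)
                   (_≟_ : DecidableEquality A) where

  open IsGroup (IsAbelianGroup.isGroup isAbelianGroup) using (_\\_)
  private
    G : AbelianGroup _ _
    G = record { isAbelianGroup = isAbelianGroup }
  open AbelianGroupProperties G using (y≈x\\z; \\-leftDividesˡ)
  open CommutativeSemigroupProperties (AbelianGroup.commutativeSemigroup G) using (x∙yz≈y∙xz)
  open CommutativeSemigroupProperties +-commutativeSemigroup using (xy∙z≈xz∙y)

  sum : List A → A
  sum = foldr _+_ 0#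

  count : List A → ℕ → A → ℕ
  count xs m z = length (filter (λ s → sum s ≟ z) (multisets xs m))

  count-∷-suc : ∀ x xs m z → count (x ∷ xs) (suc m) z ≡ count (x ∷ xs) m (x \\ z) +ℕ count xs (suc m) z
  count-∷-suc x xs m z = begin
    length (filter P? (map (x ∷_) M ++ N))
      ≡⟨ cong length (filter-++ P? (map (x ∷_) M) N) ⟩
    length (filter P? (map (x ∷_) M) ++ filter P? N)
      ≡⟨ length-++ (filter P? (map (x ∷_) M)) ⟩
    length (filter P? (map (x ∷_) M)) +ℕ count xs (suc m) z
      ≡⟨ cong (λ L → length L +ℕ count xs (suc m) z) (filter-map P? (x ∷_) M) ⟩
    length (map (x ∷_) (filter (P? ∘ (x ∷_)) M)) +ℕ count xs (suc m) z
      ≡⟨ cong (_+ℕ count xs (suc m) z) (length-map (x ∷_) (filter (P? ∘ (x ∷_)) M)) ⟩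
    length (filter (P? ∘ (x ∷_)) M) +ℕ count xs (suc m) z
      ≡⟨ cong (λ L → length L +ℕ count xs (suc m) z) (filter-≐ _ _ sum-∷≐ M) ⟩
    count (x ∷ xs) m (x \\ z) +ℕ count xs (suc m) z ∎
    where
      open ≡-Reasoning
      P? = λ s → sum s ≟ z
      M = multisets (x ∷ xs) m
      N = multisets xs (suc m)
      sum-∷≐ = (λ {s} e → y≈x\\z x (sum s) z e)
             , (λ {s} e → trans (cong (x +_) e) (\\-leftDividesˡ x z))

  count-∷-∷-suc : ∀ x y xs m z →
    count (x ∷ y ∷ xs) (suc m) z ≡ count (x ∷ y ∷ xs) m (x \\ z) +ℕ count (y ∷ xs) m (y \\ z) +ℕ count xs (suc m) z
  count-∷-∷-suc x y xs m z = begin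
    count (x ∷ y ∷ xs) (suc m) z                            ≡⟨ count-∷-suc x (y ∷ xs) m z ⟩
    Aˣ +ℕ count (y ∷ xs) (suc m) z                          ≡⟨ cong (Aˣ +ℕ_) (count-∷-suc y xs m z) ⟩
    Aˣ +ℕ (count (y ∷ xs) m (y \\ z) +ℕ count xs (suc m) z) ≡⟨ sym (+-assoc Aˣ _ (count xs (suc m) z)) ⟩
    Aˣ +ℕ count (y ∷ xs) m (y \\ z) +ℕ count xs (suc m) z   ∎
    where
      open ≡-Reasoning
      Aˣ = count (x ∷ y ∷ xs) m (x \\ z)

  count-∷-cong : ∀ x {xs ys} → (∀ m z → count xs m z ≡ count ys m z) →
                 ∀ m z → count (x ∷ xs) m z ≡ count (x ∷ ys) m z
  count-∷-cong x h zero    z = refl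
  count-∷-cong x {xs} {ys} h (suc m) z = begin
    count (x ∷ xs) (suc m) z                             ≡⟨ count-∷-suc x xs m z ⟩
    count (x ∷ xs) m (x \\ z) +ℕ count xs (suc m) z      ≡⟨ cong₂ _+ℕ_ (count-∷-cong x h m (x \\ z)) (h (suc m) z) ⟩
    count (x ∷ ys) m (x \\ z) +ℕ count ys (suc m) z      ≡⟨ sym (count-∷-suc x ys m z) ⟩
    count (x ∷ ys) (suc m) z                             ∎
    where open ≡-Reasoning

  module _ (x y : A) (xs : List A) where
    private
      xy yx : List A
      xy = x ∷ y ∷ xs
      yx = y ∷ x ∷ xs

    mutual
      count-swap : ∀ m z → count xy m z ≡ count yx m z
      count-swap zero    z = refl
      count-swap (suc m) z = begin
        count xy (suc m) z                                                        ≡⟨ count-∷-∷-suc x y xs m z ⟩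
        count xy m (x \\ z) +ℕ count (y ∷ xs) m (y \\ z) +ℕ count xs (suc m) z   ≡⟨ cong (_+ℕ count xs (suc m) z) (count-containing-x-or-y m z) ⟩
        count yx m (y \\ z) +ℕ count (x ∷ xs) m (x \\ z) +ℕ count xs (suc m) z   ≡⟨ sym (count-∷-∷-suc y x xs m z) ⟩
        count yx (suc m) z                                                        ∎
        where open ≡-Reasoning

      -- Both sides count the (m + 1)-multisets from x ∷ y ∷ xs of sum z that contain x or y.
      count-containing-x-or-y : ∀ m z →
        count xy m (x \\ z) +ℕ count (y ∷ xs) m (y \\ z) ≡ count yx m (y \\ z) +ℕ count (x ∷ xs) m (x \\ z)
      count-containing-x-or-y zero    z = +-comm (count xy 0 (x \\ z)) (count yx 0 (y \\ z))
      count-containing-x-or-y (suc k) z = begin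
        count xy (suc k) (x \\ z) +ℕ Bʸ
          ≡⟨ cong (_+ℕ Bʸ) (count-swap (suc k) (x \\ z)) ⟩
        count yx (suc k) (x \\ z) +ℕ Bʸ
          ≡⟨ cong (_+ℕ Bʸ) (count-∷-suc y (x ∷ xs) k (x \\ z)) ⟩
        count yx k (y \\ (x \\ z)) +ℕ Bˣ +ℕ Bʸ
          ≡⟨ xy∙z≈xz∙y (count yx k (y \\ (x \\ z))) Bˣ Bʸ ⟩
        count yx k (y \\ (x \\ z)) +ℕ Bʸ +ℕ Bˣ
          ≡⟨ cong (λ t → t +ℕ Bʸ +ℕ Bˣ) (sym (count-swap k _)) ⟩
        count xy k (y \\ (x \\ z)) +ℕ Bʸ +ℕ Bˣ
          ≡⟨ cong (λ w → count xy k w +ℕ Bʸ +ℕ Bˣ) (x∙yz≈y∙xz (- y) (- x) z) ⟩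
        count xy k (x \\ (y \\ z)) +ℕ Bʸ +ℕ Bˣ
          ≡⟨ cong (_+ℕ Bˣ) (sym (count-∷-suc x (y ∷ xs) k (y \\ z))) ⟩
        count xy (suc k) (y \\ z) +ℕ Bˣ
          ≡⟨ cong (_+ℕ Bˣ) (count-swap (suc k) (y \\ z)) ⟩
        count yx (suc k) (y \\ z) +ℕ Bˣ ∎
        where
          open ≡-Reasoning
          Bˣ = count (x ∷ xs) (suc k) (x \\ z)
          Bʸ = count (y ∷ xs) (suc k) (y \\ z)

  count-resp-↭ : ∀ {xs ys} → xs ↭ ys → ∀ m z → count xs m z ≡ count ys m z
  count-resp-↭ ↭.refl                   m z = refl
  count-resp-↭ (↭.prep x p)             m z = count-∷-cong x (count-resp-↭ p) m z
  count-resp-↭ (↭.swap {xs} x y p)      m z =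
    trans (count-swap x y xs m z) (count-∷-cong y (count-∷-cong x (count-resp-↭ p)) m z)
  count-resp-↭ (↭.trans p q)            m z = trans (count-resp-↭ p m z) (count-resp-↭ q m z)

  module _ {f : A → A} (f-+ : ∀ x y → f (x + y) ≡ f x + f y) (f-0# : f 0# ≡ 0#)
           (f-injective : Injective _≡_ _≡_ f) where

    sum-map : ∀ s → sum (map f s) ≡ f (sum s)
    sum-map []      = sym f-0#
    sum-map (x ∷ s) = trans (cong (f x +_) (sum-map s)) (sym (f-+ x (sum s)))

    count-map : ∀ xs m z → count (map f xs) m (f z) ≡ count xs m z
    count-map xs m z = begin
      length (filter P? (multisets (map f xs) m))                ≡⟨ cong (length ∘ filter P?) (multisets-map f xs m) ⟩
      length (filter P? (map (map f) (multisets xs m)))          ≡⟨ cong length (filter-map P? (map f) (multisets xs m)) ⟩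
      length (map (map f) (filter (P? ∘ map f) (multisets xs m))) ≡⟨ length-map (map f) (filter (P? ∘ map f) (multisets xs m)) ⟩
      length (filter (P? ∘ map f) (multisets xs m))              ≡⟨ cong length (filter-≐ _ _ sum-map≐ (multisets xs m)) ⟩
      count xs m z                                               ∎
      where
        open ≡-Reasoning
        P? = λ s → sum s ≟ f z
        sum-map≐ = (λ {s} e → f-injective (trans (sym (sum-map s)) e))
                 , (λ {s} e → trans (sum-map s) (cong f e))

module FiniteFieldCounting (F : FiniteField) where
  open FiniteField F
  open IsCommutativeRing isCommutativeRing
    using (+-isAbelianGroup; *-comm; *-assoc; *-identityˡ; zeroʳ)
  open MultisetSum +-isAbelianGroup (_≟F_ F) public

  ∈-nonzeroElements : ∀ {v} → v ∈ nonzeroElements F ⇔ v ≢ 0#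
  ∈-nonzeroElements {v} = mk⇔ (λ v∈ → proj₂ (∈-filter⁻ nonzero? {xs = elements F} v∈))
                              (∈-filter⁺ nonzero? ∈-elements)
    where
      nonzero? = λ x → ¬? (_≟F_ F x 0#)
      ∈-elements : v ∈ elements F
      ∈-elements = subst (_∈ elements F) (Inverse.strictlyInverseˡ enum v)
                         (∈-map⁺ (Inverse.to enum) (∈-allFin (Inverse.from enum v)))

  nonzeroElements-unique : Unique (nonzeroElements F)
  nonzeroElements-unique =
    Unique.filter⁺ _ (Unique.map⁺ (Injection.injective (↔⇒↣ enum)) (Unique.allFin⁺ q))

  module _ {a : Carrier} (a≢0 : a ≢ 0#) where
    private
      a⁻¹ = proj₁ (inverse a a≢0)
      open ≡-Reasoning

    inverse-*-cancel : ∀ x → a⁻¹ * (a * x) ≡ x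
    inverse-*-cancel x = begin
      a⁻¹ * (a * x) ≡⟨ sym (*-assoc a⁻¹ a x) ⟩
      (a⁻¹ * a) * x ≡⟨ cong (_* x) (trans (*-comm a⁻¹ a) (proj₂ (inverse a a≢0))) ⟩
      1# * x        ≡⟨ *-identityˡ x ⟩
      x             ∎

    *-cancelˡ : Injective _≡_ _≡_ (a *_)
    *-cancelˡ {x} {y} e = begin
      x             ≡⟨ sym (inverse-*-cancel x) ⟩
      a⁻¹ * (a * x) ≡⟨ cong (a⁻¹ *_) e ⟩
      a⁻¹ * (a * y) ≡⟨ inverse-*-cancel y ⟩
      y             ∎

    *-inverse-cancel : ∀ x → a * (a⁻¹ * x) ≡ x
    *-inverse-cancel x = begin
      a * (a⁻¹ * x) ≡⟨ sym (*-assoc a a⁻¹ x) ⟩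
      (a * a⁻¹) * x ≡⟨ cong (_* x) (proj₂ (inverse a a≢0)) ⟩
      1# * x        ≡⟨ *-identityˡ x ⟩
      x             ∎

    *-nonzero : ∀ {x} → x ≢ 0# → a * x ≢ 0#
    *-nonzero x≢0 ax≡0 = x≢0 (*-cancelˡ (trans ax≡0 (sym (zeroʳ a))))

    nonzeroElements-↭-scaled : nonzeroElements F ↭ map (a *_) (nonzeroElements F)
    nonzeroElements-↭-scaled = ∼bag⇒↭ (unique∧set⇒bag nonzeroElements-unique
      (Unique.map⁺ *-cancelˡ nonzeroElements-unique) (mk⇔ scaled⁺ scaled⁻))
      where
        open Equivalence using (to; from)
        scaled⁺ : ∀ {v} → v ∈ nonzeroElements F → v ∈ map (a *_) (nonzeroElements F)
        scaled⁺ {v} v∈ = subst (_∈ map (a *_) (nonzeroElements F)) (*-inverse-cancel v)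
          (∈-map⁺ (a *_) (from ∈-nonzeroElements λ a⁻¹v≡0 →
            to ∈-nonzeroElements v∈ (trans (sym (*-inverse-cancel v)) (trans (cong (a *_) a⁻¹v≡0) (zeroʳ a)))))
        scaled⁻ : ∀ {v} → v ∈ map (a *_) (nonzeroElements F) → v ∈ nonzeroElements F
        scaled⁻ v∈ with ∈-map⁻ (a *_) v∈
        ... | u , u∈ , refl = from ∈-nonzeroElements (*-nonzero (to ∈-nonzeroElements u∈))

lemma1 : (F : FiniteField) (a : FiniteField.Carrier F) → a ≢ FiniteField.0# F →
         (m : ℕ) → P̃ F (suc m) a ≡ P̃ F (suc m) (FiniteField.1# F)
lemma1 F a a≢0 m = begin
  count ns (suc m) a                     ≡⟨ count-resp-↭ (nonzeroElements-↭-scaled a≢0) (suc m) a ⟩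
  count (map (a *_) ns) (suc m) a        ≡⟨ cong (count (map (a *_) ns) (suc m)) (sym (*-identityʳ a)) ⟩
  count (map (a *_) ns) (suc m) (a * 1#) ≡⟨ count-map (distribˡ a) (zeroʳ a) (*-cancelˡ a≢0) ns (suc m) 1# ⟩
  count ns (suc m) 1#                    ∎
  where
    open ≡-Reasoning
    open FiniteFieldCounting F
    open FiniteField F using (_*_; 1#; isCommutativeRing)
    open IsCommutativeRing isCommutativeRing using (*-identityʳ; zeroʳ; distribˡ)
    ns = nonzeroElements F
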